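{- Let $n,k$ be positive integers and $s_1,s_2,t_1,t_2 \in \mathbb{Z}_k$ with $t_1\neq 0$, $t_2 \neq 0$, $t_1\neq t_2$. If $s_1-s_2\equiv t_1-t_2 \pmod k$, then every vertex of $Y(s_1,t_1)$ is adjacent in $H(n,k)$ to exactly one vertex of $Y(s_2,t_2)$.
   Context: The Hamming graph $H(n,k)$ has vertex set $\mathbb{Z}_k^n$ with $\mathbb{Z}_k=\{0,1,\dots,k-1\}$, two vertices being adjacent iff they differ in exactly one coordinate; $v(i)$ is the $i$-th coordinate of $v$ and arithmetic is modulo $k$. For $v \neq (0,\dots,0)$, $\ell(v)$ is the largest index $i$ with $v(i)\neq 0$. For $s,t\in\mathbb{Z}_k$ with $t\neq 0$, $Y(s,t)$ is the set of nonzero vertices $v$ with $\sum_{i=1}^n v(i)\equiv s \pmod k$ and $v(\ell(v)) = t$. -}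

module Defs where

open import Data.Nat using (ℕ; zero; suc; _+_; _%_; _<_; NonZero)
open import Data.Fin using (Fin; toℕ)
open import Data.Product using (Σ; _×_; ∃; ∃-syntax)
open import Relation.Binary.PropositionalEquality using (_≡_; _≢_)
open import Relation.Nullary using (¬_)

-- Z_k is represented by Fin k; a vertex of H(n,k) is a function Fin n → Fin k
-- (coordinates indexed 0..n-1 instead of 1..n).
Vertex : ℕ → ℕ → Set
Vertex n k = Fin n → Fin k

-- the zero element of Z_k, as a predicate on coordinates (avoids needing k > 0)
IsZero : ∀ {k} → Fin k → Set
IsZero x = toℕ x ≡ 0

coordSum : ∀ {n k} → Vertex n k → ℕ
coordSum {zero}  v = 0
coordSum {suc n} v = toℕ (v Data.Fin.zero) + coordSum {n} (λ i → v (Data.Fin.suc i))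

Adjacent : ∀ {n k} → Vertex n k → Vertex n k → Set
Adjacent {n} u v =
  Σ (Fin n) λ i → (u i ≢ v i) × (∀ j → j ≢ i → u j ≡ v j)

-- v is nonzero and v(ℓ(v)) = t, where ℓ(v) is the largest index i with v(i) ≠ 0:
-- there is an index i with v(i) = t ≠ 0 and all later coordinates are 0.
LastNonzeroIs : ∀ {n k} → Vertex n k → Fin k → Set
LastNonzeroIs {n} v t =
  ¬ IsZero t × Σ (Fin n) λ i → (v i ≡ t) × (∀ j → toℕ i < toℕ j → IsZero (v j))

InY : ∀ {n k} .{{_ : NonZero k}} → Fin k → Fin k → Vertex n k → Set
InY {k = k} s t v =
  (¬ (∀ i → IsZero (v i))) × (coordSum v % k ≡ toℕ s) × LastNonzeroIs v t

{-# OPTIONS --safe #-}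
module Submission where

-- The neighbour replaces the last nonzero coordinate t₁ of v by t₂, which shifts the
-- coordinate sum by t₂ − t₁ ≡ s₂ − s₁. Conversely, let w′ ∈ Y(s₂,t₂) differ from v only
-- at i. If i lay before the last nonzero coordinate of v or of w′, that coordinate would
-- be the last nonzero one of both, forcing t₁ = t₂. So i is at or after both, and
-- comparing coordinate sums shows it cannot be the last nonzero coordinate of just one
-- of them (that would force t₁ ≡ 0 or t₂ ≡ 0); hence w′ is the neighbour above.

open import Defs
open import Data.Nat using (ℕ; _+_; _%_; _≤_; NonZero; zero; suc; _*_; _∸_; >-nonZero⁻¹)
  renaming (_<_ to _<ℕ_)
open import Data.Nat.Properties using (m≤m*n; +-assoc; m+[n∸m]≡n; +-identityʳ; +-comm; +-commutativeSemigroup)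
open import Data.Nat.DivMod using (m%n%n≡m%n; %-distribˡ-+; [m+kn]%n≡m%n; m<n⇒m%n≡m)
open import Data.Fin using (Fin; toℕ; _<_; _≟_) renaming (zero to fzero; suc to fsuc)
open import Data.Fin.Properties using (toℕ-injective; toℕ<n; suc-injective; <-cmp; <-trans; <⇒≢)
open import Data.Vec.Functional using (updateAt)
open import Data.Vec.Functional.Properties using (updateAt-updates; updateAt-minimal)
open import Data.Product using (Σ; _×_; _,_; proj₁; proj₂)
open import Data.Empty using (⊥-elim)
open import Function using (const; _∘_)
open import Relation.Binary.Definitions using (tri<; tri≈; tri>)
open import Relation.Binary.PropositionalEquality
open import Relation.Nullary using (¬_; yes; no)
open import Algebra.Properties.CommutativeSemigroup +-commutativeSemigroup using (xy∙z≈zy∙x)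

module _ {k : ℕ} .{{_ : NonZero k}} where

  [m%k+n]%k≡[m+n]%k : ∀ m n → (m % k + n) % k ≡ (m + n) % k
  [m%k+n]%k≡[m+n]%k m n = begin
    (m % k + n) % k           ≡⟨ %-distribˡ-+ (m % k) n k ⟩
    (m % k % k + n % k) % k   ≡⟨ cong (λ x → (x + n % k) % k) (m%n%n≡m%n m k) ⟩
    (m % k + n % k) % k       ≡⟨ %-distribˡ-+ m n k ⟨
    (m + n) % k               ∎
    where open ≡-Reasoning

  %-cancelʳ-+ : ∀ m n o → (m + o) % k ≡ (n + o) % k → m % k ≡ n % k
  %-cancelʳ-+ m n o eq = begin
    m % k                            ≡⟨ unshift m ⟩
    ((m + o) % k + (o * k ∸ o)) % k  ≡⟨ cong (λ x → (x + (o * k ∸ o)) % k) eq ⟩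
    ((n + o) % k + (o * k ∸ o)) % k  ≡⟨ unshift n ⟨
    n % k                            ∎
    where
    open ≡-Reasoning
    -- o + (o * k ∸ o) = o * k, so adding o can be undone modulo k
    unshift : ∀ x → x % k ≡ ((x + o) % k + (o * k ∸ o)) % k
    unshift x = begin
      x % k                           ≡⟨ [m+kn]%n≡m%n x o k ⟨
      (x + o * k) % k                 ≡⟨ cong (λ y → (x + y) % k) (m+[n∸m]≡n (m≤m*n o k)) ⟨
      (x + (o + (o * k ∸ o))) % k     ≡⟨ cong (_% k) (+-assoc x o _) ⟨
      (x + o + (o * k ∸ o)) % k       ≡⟨ [m%k+n]%k≡[m+n]%k (x + o) _ ⟨
      ((x + o) % k + (o * k ∸ o)) % k ∎

  [m+n]%k≡m%k⇒n≡0 : ∀ m {n} → n <ℕ k → (m + n) % k ≡ m % k → n ≡ 0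
  [m+n]%k≡m%k⇒n≡0 m {n} n<k eq = begin
    n      ≡⟨ m<n⇒m%n≡m n<k ⟨
    n % k  ≡⟨ %-cancelʳ-+ n 0 m (trans (cong (_% k) (+-comm n m)) eq) ⟩
    0 % k  ≡⟨ m<n⇒m%n≡m (>-nonZero⁻¹ k) ⟩
    0      ∎
    where open ≡-Reasoning

AgreeOff : ∀ {n k} → Fin n → Vertex n k → Vertex n k → Set
AgreeOff i u v = ∀ j → j ≢ i → u j ≡ v j

AgreeOff-sym : ∀ {n k i} {u v : Vertex n k} → AgreeOff i u v → AgreeOff i v u
AgreeOff-sym agree j j≢i = sym (agree j j≢i)

LastNonzeroAt : ∀ {n k} → Vertex n k → Fin n → Set
LastNonzeroAt v p = ¬ IsZero (v p) × (∀ j → p < j → IsZero (v j))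

lastNonzeroAt-unique : ∀ {n k} {v : Vertex n k} {p q} →
                       LastNonzeroAt v p → LastNonzeroAt v q → p ≡ q
lastNonzeroAt-unique {p = p} {q} (vp≢0 , after-p) (vq≢0 , after-q) with <-cmp p q
... | tri< p<q _ _ = ⊥-elim (vq≢0 (after-p q p<q))
... | tri≈ _ p≡q _ = p≡q
... | tri> _ _ q<p = ⊥-elim (vp≢0 (after-q p q<p))

lastNonzeroAt-agreeOff : ∀ {n k} {u v : Vertex n k} {i p} → AgreeOff i u v → i < p →
                         LastNonzeroAt v p → LastNonzeroAt u p
lastNonzeroAt-agreeOff {p = p} agree i<p (vp≢0 , after) =
  vp≢0 ∘ subst IsZero (agree p (<⇒≢ i<p ∘ sym)) ,
  λ j p<j → subst IsZero (sym (agree j (<⇒≢ (<-trans i<p p<j) ∘ sym))) (after j p<j)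

coordSum-cong : ∀ {n k} {u v : Vertex n k} → (∀ i → u i ≡ v i) → coordSum u ≡ coordSum v
coordSum-cong {zero}  u≗v = refl
coordSum-cong {suc n} u≗v = cong₂ _+_ (cong toℕ (u≗v fzero)) (coordSum-cong (u≗v ∘ fsuc))

coordSum-exchange : ∀ {n k} {u v : Vertex n k} i → AgreeOff i u v →
                    coordSum u + toℕ (v i) ≡ coordSum v + toℕ (u i)
coordSum-exchange {suc n} {u = u} {v} fzero agree = begin
  toℕ (u fzero) + coordSum (u ∘ fsuc) + toℕ (v fzero)
    ≡⟨ cong (λ x → toℕ (u fzero) + x + toℕ (v fzero)) (coordSum-cong (λ j → agree (fsuc j) λ ())) ⟩
  toℕ (u fzero) + coordSum (v ∘ fsuc) + toℕ (v fzero)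
    ≡⟨ xy∙z≈zy∙x (toℕ (u fzero)) _ _ ⟩
  toℕ (v fzero) + coordSum (v ∘ fsuc) + toℕ (u fzero) ∎
  where open ≡-Reasoning
coordSum-exchange {suc n} {u = u} {v} (fsuc i) agree = begin
  toℕ (u fzero) + coordSum (u ∘ fsuc) + toℕ (v (fsuc i))
    ≡⟨ +-assoc (toℕ (u fzero)) _ _ ⟩
  toℕ (u fzero) + (coordSum (u ∘ fsuc) + toℕ (v (fsuc i)))
    ≡⟨ cong₂ _+_ (cong toℕ (agree fzero λ ()))
                 (coordSum-exchange i λ j j≢i → agree (fsuc j) (j≢i ∘ suc-injective)) ⟩
  toℕ (v fzero) + (coordSum (v ∘ fsuc) + toℕ (u (fsuc i)))
    ≡⟨ +-assoc (toℕ (v fzero)) _ _ ⟨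
  toℕ (v fzero) + coordSum (v ∘ fsuc) + toℕ (u (fsuc i)) ∎
  where open ≡-Reasoning

coordSum-exchange-% : ∀ {n k} .{{_ : NonZero k}} {u v : Vertex n k} {a b} i → AgreeOff i u v →
                      coordSum u % k ≡ a → coordSum v % k ≡ b →
                      (a + toℕ (v i)) % k ≡ (b + toℕ (u i)) % k
coordSum-exchange-% {k = k} {u = u} {v} i agree refl refl = begin
  (coordSum u % k + toℕ (v i)) % k  ≡⟨ [m%k+n]%k≡[m+n]%k (coordSum u) _ ⟩
  (coordSum u + toℕ (v i)) % k      ≡⟨ cong (_% k) (coordSum-exchange i agree) ⟩
  (coordSum v + toℕ (u i)) % k      ≡⟨ [m%k+n]%k≡[m+n]%k (coordSum v) _ ⟨
  (coordSum v % k + toℕ (u i)) % k  ∎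
  where open ≡-Reasoning

updateAt-const-unique : ∀ {n k} {u v : Vertex n k} {p t} → AgreeOff p u v → u p ≡ t →
                        ∀ j → u j ≡ updateAt v p (const t) j
updateAt-const-unique {v = v} {p} agree up≡t j with j ≟ p
... | yes refl = trans up≡t (sym (updateAt-updates p v))
... | no j≢p   = trans (agree j j≢p) (sym (updateAt-minimal j p v j≢p))

module ReplaceLastNonzero {n k : ℕ} .{{_ : NonZero k}} {s₁ s₂ t₁ t₂ : Fin k}
         (t₁≢0 : ¬ IsZero t₁) (t₂≢0 : ¬ IsZero t₂) (t₁≢t₂ : t₁ ≢ t₂)
         (s₁+t₂≡s₂+t₁ : (toℕ s₁ + toℕ t₂) % k ≡ (toℕ s₂ + toℕ t₁) % k)
         {v : Vertex n k} {p : Fin n}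
         (Σv≡s₁ : coordSum v % k ≡ toℕ s₁) (vp≡t₁ : v p ≡ t₁) (v-last : LastNonzeroAt v p) where

  private
    w : Vertex n k
    w = updateAt v p (const t₂)

    wp≡t₂ : w p ≡ t₂
    wp≡t₂ = updateAt-updates p v

    w-agreeOff : AgreeOff p w v
    w-agreeOff j j≢p = updateAt-minimal j p v j≢p

  updateAt-adjacent : Adjacent v w
  updateAt-adjacent = p , (λ vp≡wp → t₁≢t₂ (trans (sym vp≡t₁) (trans vp≡wp wp≡t₂))) , AgreeOff-sym w-agreeOff

  updateAt-InY : InY s₂ t₂ w
  updateAt-InY = (λ w≡0 → t₂≢0 (subst IsZero wp≡t₂ (w≡0 p))) , Σw≡s₂ , t₂≢0 , p , wp≡t₂ , w-after
    where
    w-after : ∀ j → p < j → IsZero (w j)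
    w-after j p<j = subst IsZero (sym (w-agreeOff j (<⇒≢ p<j ∘ sym))) (proj₂ v-last j p<j)
    Σw≡s₂ : coordSum w % k ≡ toℕ s₂
    Σw≡s₂ = begin
      coordSum w % k      ≡⟨ m%n%n≡m%n (coordSum w) k ⟨
      coordSum w % k % k  ≡⟨ %-cancelʳ-+ _ (toℕ s₂) (toℕ t₁) (begin
          (coordSum w % k + toℕ t₁) % k     ≡⟨ cong (λ x → (coordSum w % k + toℕ x) % k) vp≡t₁ ⟨
          (coordSum w % k + toℕ (v p)) % k  ≡⟨ coordSum-exchange-% p w-agreeOff refl Σv≡s₁ ⟩
          (toℕ s₁ + toℕ (w p)) % k          ≡⟨ cong (λ x → (toℕ s₁ + toℕ x) % k) wp≡t₂ ⟩
          (toℕ s₁ + toℕ t₂) % k             ≡⟨ s₁+t₂≡s₂+t₁ ⟩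
          (toℕ s₂ + toℕ t₁) % k             ∎) ⟩
      toℕ s₂ % k          ≡⟨ m<n⇒m%n≡m (toℕ<n s₂) ⟩
      toℕ s₂              ∎
      where open ≡-Reasoning

  updateAt-InY-unique : ∀ {w′} → InY s₂ t₂ w′ → Adjacent v w′ → ∀ j → w′ j ≡ w j
  updateAt-InY-unique {w′} (_ , Σw′≡s₂ , _ , q , w′q≡t₂ , after′) (i , vi≢w′i , agree) =
    updateAt-const-unique w′-agreeOff w′p≡t₂
    where
    open ≡-Reasoning
    w′-last : LastNonzeroAt w′ q
    w′-last = t₂≢0 ∘ subst IsZero w′q≡t₂ , after′

    exchange : (toℕ s₁ + toℕ (w′ i)) % k ≡ (toℕ s₂ + toℕ (v i)) % k
    exchange = coordSum-exchange-% i agree Σv≡s₁ Σw′≡s₂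

    ¬i<p : ¬ i < p
    ¬i<p i<p = t₁≢t₂ (begin
      t₁    ≡⟨ vp≡t₁ ⟨
      v p   ≡⟨ agree p (<⇒≢ i<p ∘ sym) ⟩
      w′ p  ≡⟨ cong w′ (lastNonzeroAt-unique (lastNonzeroAt-agreeOff (AgreeOff-sym agree) i<p v-last) w′-last) ⟩
      w′ q  ≡⟨ w′q≡t₂ ⟩
      t₂    ∎)

    ¬i<q : ¬ i < q
    ¬i<q i<q = t₁≢t₂ (begin
      t₁    ≡⟨ vp≡t₁ ⟨
      v p   ≡⟨ cong v (lastNonzeroAt-unique v-last (lastNonzeroAt-agreeOff agree i<q w′-last)) ⟩
      v q   ≡⟨ agree q (<⇒≢ i<q ∘ sym) ⟩
      w′ q  ≡⟨ w′q≡t₂ ⟩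
      t₂    ∎)

    ¬p<i≡q : p < i → i ≢ q
    ¬p<i≡q p<i i≡q = t₁≢0 ([m+n]%k≡m%k⇒n≡0 (toℕ s₂) (toℕ<n t₁) (begin
      (toℕ s₂ + toℕ t₁) % k        ≡⟨ s₁+t₂≡s₂+t₁ ⟨
      (toℕ s₁ + toℕ t₂) % k        ≡⟨ cong (λ x → (toℕ s₁ + toℕ x) % k) (trans (cong w′ i≡q) w′q≡t₂) ⟨
      (toℕ s₁ + toℕ (w′ i)) % k    ≡⟨ exchange ⟩
      (toℕ s₂ + toℕ (v i)) % k     ≡⟨ cong (λ x → (toℕ s₂ + x) % k) (proj₂ v-last i p<i) ⟩
      (toℕ s₂ + 0) % k             ≡⟨ cong (_% k) (+-identityʳ (toℕ s₂)) ⟩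
      toℕ s₂ % k                   ∎))

    ¬q<i≡p : q < i → i ≢ p
    ¬q<i≡p q<i i≡p = t₂≢0 ([m+n]%k≡m%k⇒n≡0 (toℕ s₁) (toℕ<n t₂) (begin
      (toℕ s₁ + toℕ t₂) % k        ≡⟨ s₁+t₂≡s₂+t₁ ⟩
      (toℕ s₂ + toℕ t₁) % k        ≡⟨ cong (λ x → (toℕ s₂ + toℕ x) % k) (trans (cong v i≡p) vp≡t₁) ⟨
      (toℕ s₂ + toℕ (v i)) % k     ≡⟨ exchange ⟨
      (toℕ s₁ + toℕ (w′ i)) % k    ≡⟨ cong (λ x → (toℕ s₁ + x) % k) (after′ i q<i) ⟩
      (toℕ s₁ + 0) % k             ≡⟨ cong (_% k) (+-identityʳ (toℕ s₁)) ⟩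
      toℕ s₁ % k                   ∎))

    i≡p×i≡q : i ≡ p × i ≡ q
    i≡p×i≡q with <-cmp i p | <-cmp i q
    ... | tri< i<p _ _  | _             = ⊥-elim (¬i<p i<p)
    ... | _             | tri< i<q _ _  = ⊥-elim (¬i<q i<q)
    ... | tri> _ _ p<i  | tri> _ _ q<i  =
      ⊥-elim (vi≢w′i (toℕ-injective (trans (proj₂ v-last i p<i) (sym (after′ i q<i)))))
    ... | tri> _ _ p<i  | tri≈ _ i≡q _  = ⊥-elim (¬p<i≡q p<i i≡q)
    ... | tri≈ _ i≡p _  | tri> _ _ q<i  = ⊥-elim (¬q<i≡p q<i i≡p)
    ... | tri≈ _ i≡p _  | tri≈ _ i≡q _  = i≡p , i≡q

    w′-agreeOff : AgreeOff p w′ v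
    w′-agreeOff = subst (λ i → AgreeOff i w′ v) (proj₁ i≡p×i≡q) (AgreeOff-sym agree)

    w′p≡t₂ : w′ p ≡ t₂
    w′p≡t₂ = trans (cong w′ (trans (sym (proj₁ i≡p×i≡q)) (proj₂ i≡p×i≡q))) w′q≡t₂

lemma15 : (n k : ℕ) → 1 ≤ n → .{{_ : NonZero k}} → (s₁ s₂ t₁ t₂ : Fin k) →
            ¬ IsZero t₁ → ¬ IsZero t₂ → t₁ ≢ t₂ →
            (toℕ s₁ + toℕ t₂) % k ≡ (toℕ s₂ + toℕ t₁) % k →
            (v : Vertex n k) → InY s₁ t₁ v →
            Σ (Vertex n k) λ w →
              (InY s₂ t₂ w × Adjacent v w) ×
              ((w′ : Vertex n k) → InY s₂ t₂ w′ → Adjacent v w′ →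
                 ∀ i → w′ i ≡ w i)
lemma15 n k _ s₁ s₂ t₁ t₂ t₁≢0 t₂≢0 t₁≢t₂ s₁+t₂≡s₂+t₁ v (_ , Σv≡s₁ , _ , p , vp≡t₁ , after) =
  updateAt v p (const t₂) , (updateAt-InY , updateAt-adjacent) , λ _ → updateAt-InY-unique
  where
  open ReplaceLastNonzero t₁≢0 t₂≢0 t₁≢t₂ s₁+t₂≡s₂+t₁ Σv≡s₁ vp≡t₁ (t₁≢0 ∘ subst IsZero vp≡t₁ , after)
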